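{- Let $M\models Th(\mathbb{N})$. Then $(M_K,0_K,1_K,+_K,\cdot_K,<_K)$ is elementarily equivalent to $(M,0,1,+,\cdot,<)$, where $+_K,\cdot_K,<_K$ are the restrictions to $M_K$ of the operations and order of $K_M$.
   Context: For $M\models Th(\mathbb{N})$, $K_M$ is the ordered field of equivalence classes of $M$-reals: functions $M\to(-M\cup M)\times(M\setminus\{0\})$, $i\mapsto(a_i,b_i)$, definable in $M$ by $\mathfrak{L}_{PA}$-formulas with parameters, whose fraction sequence $x_i=a_i/b_i$ is Cauchy (for every $m\in M^{>0}$ there is $n$ with $m|x_{k_1}-x_{k_2}|<1$ for $k_1,k_2>n$), two being equivalent if for every $m\in M^{>0}$ eventually $m|x_k-y_k|<1$; operations are termwise and $[x]<[y]$ iff there are $m,k\in M$, $m>0$, with $mx_l+1<my_l$ for all $l>k$. For $n\in M$, $n_K$ is the class of the constant sequence with value $n$, and $M_K=\{n_K: n\in M\}$. -}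

module Defs where

open import Level using (0ℓ)
open import Data.Nat using (ℕ) renaming (_+_ to _+ℕ_; _*_ to _*ℕ_; _<_ to _<ℕ_)
open import Data.Fin using (Fin; zero; suc)
open import Data.Bool using (Bool; true; false; _xor_)
open import Data.List using (List; []; _∷_; _++_; map; concatMap; foldr)
open import Data.Product using (Σ; ∃; _×_; _,_)
open import Data.Sum using (_⊎_)
open import Data.Empty using (⊥)
open import Relation.Nullary using (¬_)
open import Relation.Binary.PropositionalEquality using (_≡_)

data Term (n : ℕ) : Set where
  var  : Fin n → Term n
  zer  : Term n
  one  : Term n
  _⊕_  : Term n → Term n → Term n
  _⊗_  : Term n → Term n → Term n

data Formula (n : ℕ) : Set where
  _≐_  : Term n → Term n → Formula n
  _≺_  : Term n → Term n → Formula n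
  ⊥f   : Formula n
  _⇒_  : Formula n → Formula n → Formula n
  _∧f_ : Formula n → Formula n → Formula n
  _∨f_ : Formula n → Formula n → Formula n
  ∀f   : Formula (ℕ.suc n) → Formula n
  ∃f   : Formula (ℕ.suc n) → Formula n

Sentence : Set
Sentence = Formula 0

-- For uniform semantics (needed for M_K, whose operations are
-- only given as graphs on equivalence classes) we interpret in
-- "relational structures": equality by a relation _≈_, constants and
-- operations by their graphs.

record PAStr : Set₁ where
  field
    Carrier : Set
    0#  : Carrier
    1#  : Carrier
    _+_ : Carrier → Carrier → Carrier
    _*_ : Carrier → Carrier → Carrier
    _<_ : Carrier → Carrier → Set

record RelStr : Set₁ where
  field
    Carrier : Set
    _≈_  : Carrier → Carrier → Set
    IsZ  : Carrier → Set
    IsO  : Carrier → Set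
    Add  : Carrier → Carrier → Carrier → Set
    Mul  : Carrier → Carrier → Carrier → Set
    Lt   : Carrier → Carrier → Set

toRel : PAStr → RelStr
toRel M = record
  { Carrier = Carrier
  ; _≈_ = _≡_
  ; IsZ = λ v → v ≡ 0#
  ; IsO = λ v → v ≡ 1#
  ; Add = λ a b v → (a + b) ≡ v
  ; Mul = λ a b v → (a * b) ≡ v
  ; Lt  = _<_
  }
  where open PAStr M

ext : {A : Set} {n : ℕ} → (Fin n → A) → A → Fin (ℕ.suc n) → A
ext ρ a zero    = a
ext ρ a (suc i) = ρ i

module Semantics (S : RelStr) where
  open RelStr S

  Val : {n : ℕ} → Term n → (Fin n → Carrier) → Carrier → Set
  Val (var x) ρ v = v ≈ ρ x
  Val zer     ρ v = IsZ v
  Val one     ρ v = IsO v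
  Val (t ⊕ u) ρ v = Σ Carrier λ a → Σ Carrier λ b → Val t ρ a × Val u ρ b × Add a b v
  Val (t ⊗ u) ρ v = Σ Carrier λ a → Σ Carrier λ b → Val t ρ a × Val u ρ b × Mul a b v

  Sat : {n : ℕ} → Formula n → (Fin n → Carrier) → Set
  Sat (t ≐ u)  ρ = Σ Carrier λ a → Σ Carrier λ b → Val t ρ a × Val u ρ b × (a ≈ b)
  Sat (t ≺ u)  ρ = Σ Carrier λ a → Σ Carrier λ b → Val t ρ a × Val u ρ b × Lt a b
  Sat ⊥f       ρ = ⊥
  Sat (φ ⇒ ψ)  ρ = Sat φ ρ → Sat ψ ρ
  Sat (φ ∧f ψ) ρ = Sat φ ρ × Sat ψ ρ
  Sat (φ ∨f ψ) ρ = Sat φ ρ ⊎ Sat ψ ρ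
  Sat (∀f φ)   ρ = (a : Carrier) → Sat φ (ext ρ a)
  Sat (∃f φ)   ρ = Σ Carrier λ a → Sat φ (ext ρ a)

_⊨_ : RelStr → Sentence → Set
S ⊨ φ = Semantics.Sat S φ (λ ())

_≡ₑ_ : RelStr → RelStr → Set
S ≡ₑ T = (φ : Sentence) → (S ⊨ φ → T ⊨ φ) × (T ⊨ φ → S ⊨ φ)

ℕStr : PAStr
ℕStr = record
  { Carrier = ℕ ; 0# = 0 ; 1# = 1 ; _+_ = _+ℕ_ ; _*_ = _*ℕ_ ; _<_ = _<ℕ_ }

ModelOfTrueArithmetic : PAStr → Set
ModelOfTrueArithmetic M = (φ : Sentence) → toRel ℕStr ⊨ φ → toRel M ⊨ φ

-- An element of -M ∪ M is a pair (sign, magnitude)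
-- (true = negative).  To express termwise sums/differences of fractions
-- without subtraction in M, numerators are kept as formal signed sums
-- ("GFrac" = exact fraction (Σ ±cᵢ)/d with d ∈ M \ {0}).  All order
-- conditions are then stated by clearing the (positive) denominators.

module KM (M : PAStr) where
  open PAStr M

  SElt : Set
  SElt = Bool × Carrier

  SList : Set
  SList = List SElt

  posPart : SList → Carrier
  posPart = foldr (λ { (false , c) r → c + r ; (true , c) r → r }) 0#

  negPart : SList → Carrier
  negPart = foldr (λ { (false , c) r → r ; (true , c) r → c + r }) 0#

  -- the formal signed sum is > 0 in M (i.e. the integer it denotes is positive)
  Positive : SList → Set
  Positive l = negPart l < posPart l

  scale : SElt → SList → SList
  scale (s , c) = map (λ { (t , a) → (s xor t , c * a) })

  mulS : SList → SList → SList
  mulS l₁ l₂ = concatMap (λ e → scale e l₂) l₁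

  GFrac : Set
  GFrac = SList × Carrier

  frac : Bool × Carrier × Carrier → GFrac
  frac (s , a , b) = ((s , a) ∷ []) , b

  addG : GFrac → GFrac → GFrac
  addG (N₁ , d₁) (N₂ , d₂) = (scale (false , d₂) N₁ ++ scale (false , d₁) N₂) , (d₁ * d₂)

  mulG : GFrac → GFrac → GFrac
  mulG (N₁ , d₁) (N₂ , d₂) = mulS N₁ N₂ , (d₁ * d₂)

  -- numerator of x - y over the denominator d_x d_y
  diffNum : GFrac → GFrac → SList
  diffNum (N₁ , d₁) (N₂ , d₂) = scale (false , d₂) N₁ ++ scale (true , d₁) N₂

  -- m · |x - y| < 1
  Close : Carrier → GFrac → GFrac → Set
  Close m x@(N₁ , d₁) y@(N₂ , d₂) =
    Positive ((false , d₁ * d₂) ∷ scale (true , m) (diffNum x y)) ×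
    Positive ((false , d₁ * d₂) ∷ scale (false , m) (diffNum x y))

  -- m · x + 1 < m · y
  LtBy : Carrier → GFrac → GFrac → Set
  LtBy m x@(N₁ , d₁) y@(N₂ , d₂) =
    Positive ((true , d₁ * d₂) ∷ scale (false , m) (diffNum y x))

  Seq : Set
  Seq = Carrier → GFrac

  _∼_ : Seq → Seq → Set
  x ∼ y = (m : Carrier) → 0# < m →
          Σ Carrier λ n → (k : Carrier) → n < k → Close m (x k) (y k)

  _<K_ : Seq → Seq → Set
  x <K y = Σ Carrier λ m → Σ Carrier λ k →
           (0# < m) × ((l : Carrier) → k < l → LtBy m (x l) (y l))

  _+S_ : Seq → Seq → Seq
  (x +S y) i = addG (x i) (y i)

  _*S_ : Seq → Seq → Seq
  (x *S y) i = mulG (x i) (y i)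

  cst : Carrier → Seq
  cst n _ = frac (false , n , 1#)

  -- (M_K, 0_K, 1_K, +_K, ·_K, <_K): the element n_K is named by n ∈ M;
  -- equality is equality of classes in K_M, operations/order are those
  -- of K_M restricted to M_K (given by their graphs).
  MK : RelStr
  MK = record
    { Carrier = Carrier
    ; _≈_ = λ n m → cst n ∼ cst m
    ; IsZ = λ v → cst v ∼ cst 0#
    ; IsO = λ v → cst v ∼ cst 1#
    ; Add = λ a b v → cst v ∼ (cst a +S cst b)
    ; Mul = λ a b v → cst v ∼ (cst a *S cst b)
    ; Lt  = λ a b → cst a <K cst b
    }

  -- M_K is closed under +_K and ·_K (so the restrictions are operations)
  MKClosed : Set
  MKClosed = ((a b : Carrier) → Σ Carrier λ v → cst v ∼ (cst a +S cst b)) ×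
             ((a b : Carrier) → Σ Carrier λ v → cst v ∼ (cst a *S cst b))

LEM : Set₁
LEM = (P : Set) → P ⊎ ¬ P

-- The map n ↦ n_K is an isomorphism from M onto M_K.  Equality in K_M of
-- constant classes, and their sums, products and order, are all decided by
-- comparing exact fractions with numerator and denominator in M, and each of
-- the finitely many comparisons needed ("m|a/1 − a/1| < 1 for every m",
-- "|c/1 − (a/1 + b/1)| < 1 implies a + b = c", ...) is a first-order sentence
-- true in ℕ, hence in M.  So the relations of M_K are logically equivalent to
-- the graphs of the equality, operations and order of M, and two relational
-- structures with that property satisfy the same formulas.
module Submission where

open import Data.Bool using (false; true)
open import Data.Empty using (⊥)
open import Data.Fin using (Fin; zero; suc)
open import Data.List using (_∷_; [])
open import Data.Nat using (ℕ; suc; z≤n; s≤s)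
import Data.Nat.Properties as ℕ
open import Data.Nat.Tactic.RingSolver using (solve)
open import Data.Product using (Σ; _×_; _,_; proj₂)
open import Data.Sum using (_⊎_; inj₁; inj₂)
open import Data.Unit using (⊤)
open import Function using (_⇔_; mk⇔; Equivalence)
open import Function.Construct.Identity using (⇔-id)
open import Relation.Binary.PropositionalEquality
open import Defs

open Equivalence using (to; from)

module Functional (P : PAStr) where
  open PAStr P

  eval : ∀ {n} → Term n → (Fin n → Carrier) → Carrier
  eval (var x) ρ = ρ x
  eval zer     ρ = 0#
  eval one     ρ = 1#
  eval (t ⊕ u) ρ = eval t ρ + eval u ρ
  eval (t ⊗ u) ρ = eval t ρ * eval u ρ

  Holds : ∀ {n} → Formula n → (Fin n → Carrier) → Set
  Holds (t ≐ u)  ρ = eval t ρ ≡ eval u ρ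
  Holds (t ≺ u)  ρ = eval t ρ < eval u ρ
  Holds ⊥f       ρ = ⊥
  Holds (φ ⇒ ψ)  ρ = Holds φ ρ → Holds ψ ρ
  Holds (φ ∧f ψ) ρ = Holds φ ρ × Holds ψ ρ
  Holds (φ ∨f ψ) ρ = Holds φ ρ ⊎ Holds ψ ρ
  Holds (∀f φ)   ρ = (a : Carrier) → Holds φ (ext ρ a)
  Holds (∃f φ)   ρ = Σ Carrier λ a → Holds φ (ext ρ a)

_⊩_ : PAStr → Sentence → Set
P ⊩ σ = Functional.Holds P σ (λ ())

record Presentation (P : PAStr) : Set₁ where
  open PAStr P
  field
    _≈_    : Carrier → Carrier → Set
    IsZ    : Carrier → Set
    IsO    : Carrier → Set
    Add    : Carrier → Carrier → Carrier → Set
    Mul    : Carrier → Carrier → Carrier → Set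
    Lt     : Carrier → Carrier → Set
    ≈⇔≡    : ∀ {a b} → a ≈ b ⇔ a ≡ b
    IsZ⇔≡0 : ∀ {a} → IsZ a ⇔ a ≡ 0#
    IsO⇔≡1 : ∀ {a} → IsO a ⇔ a ≡ 1#
    Add⇔+  : ∀ {a b c} → Add a b c ⇔ a + b ≡ c
    Mul⇔*  : ∀ {a b c} → Mul a b c ⇔ a * b ≡ c
    Lt⇔<   : ∀ {a b} → Lt a b ⇔ a < b

  structure : RelStr
  structure = record
    { Carrier = Carrier ; _≈_ = _≈_ ; IsZ = IsZ ; IsO = IsO
    ; Add = Add ; Mul = Mul ; Lt = Lt }

open Presentation using (structure)

graphs : (P : PAStr) → Presentation P
graphs P = record
  { _≈_ = _≡_ ; IsZ = _≡ 0# ; IsO = _≡ 1#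
  ; Add = λ a b c → a + b ≡ c ; Mul = λ a b c → a * b ≡ c ; Lt = _<_
  ; ≈⇔≡ = ⇔-id _ ; IsZ⇔≡0 = ⇔-id _ ; IsO⇔≡1 = ⇔-id _
  ; Add⇔+ = ⇔-id _ ; Mul⇔* = ⇔-id _ ; Lt⇔< = ⇔-id _ }
  where open PAStr P

module _ {P : PAStr} (𝒫 : Presentation P) where
  open PAStr P
  open Presentation 𝒫 hiding (structure)
  open Semantics (structure 𝒫)
  open Functional P

  val-eval : ∀ {n} (t : Term n) ρ → Val t ρ (eval t ρ)
  val-eval (var x) ρ = from ≈⇔≡ refl
  val-eval zer     ρ = from IsZ⇔≡0 refl
  val-eval one     ρ = from IsO⇔≡1 refl
  val-eval (t ⊕ u) ρ = _ , _ , val-eval t ρ , val-eval u ρ , from Add⇔+ refl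
  val-eval (t ⊗ u) ρ = _ , _ , val-eval t ρ , val-eval u ρ , from Mul⇔* refl

  val⇒≡eval : ∀ {n} (t : Term n) ρ {v} → Val t ρ v → v ≡ eval t ρ
  val⇒≡eval (var x) ρ v≈ = to ≈⇔≡ v≈
  val⇒≡eval zer     ρ v0 = to IsZ⇔≡0 v0
  val⇒≡eval one     ρ v1 = to IsO⇔≡1 v1
  val⇒≡eval (t ⊕ u) ρ (a , b , ta , ub , add) =
    trans (sym (to Add⇔+ add)) (cong₂ _+_ (val⇒≡eval t ρ ta) (val⇒≡eval u ρ ub))
  val⇒≡eval (t ⊗ u) ρ (a , b , ta , ub , mul) =
    trans (sym (to Mul⇔* mul)) (cong₂ _*_ (val⇒≡eval t ρ ta) (val⇒≡eval u ρ ub))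

  sat⇒holds : ∀ {n} (φ : Formula n) ρ → Sat φ ρ → Holds φ ρ
  holds⇒sat : ∀ {n} (φ : Formula n) ρ → Holds φ ρ → Sat φ ρ

  sat⇒holds (t ≐ u) ρ (a , b , ta , ub , a≈b) =
    trans (sym (val⇒≡eval t ρ ta)) (trans (to ≈⇔≡ a≈b) (val⇒≡eval u ρ ub))
  sat⇒holds (t ≺ u) ρ (a , b , ta , ub , a<b) =
    subst₂ _<_ (val⇒≡eval t ρ ta) (val⇒≡eval u ρ ub) (to Lt⇔< a<b)
  sat⇒holds ⊥f       ρ ()
  sat⇒holds (φ ⇒ ψ)  ρ s h = sat⇒holds ψ ρ (s (holds⇒sat φ ρ h))
  sat⇒holds (φ ∧f ψ) ρ (s , s′) = sat⇒holds φ ρ s , sat⇒holds ψ ρ s′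
  sat⇒holds (φ ∨f ψ) ρ (inj₁ s) = inj₁ (sat⇒holds φ ρ s)
  sat⇒holds (φ ∨f ψ) ρ (inj₂ s) = inj₂ (sat⇒holds ψ ρ s)
  sat⇒holds (∀f φ)   ρ s a = sat⇒holds φ (ext ρ a) (s a)
  sat⇒holds (∃f φ)   ρ (a , s) = a , sat⇒holds φ (ext ρ a) s

  holds⇒sat (t ≐ u)  ρ eq = _ , _ , val-eval t ρ , val-eval u ρ , from ≈⇔≡ eq
  holds⇒sat (t ≺ u)  ρ lt = _ , _ , val-eval t ρ , val-eval u ρ , from Lt⇔< lt
  holds⇒sat ⊥f       ρ ()
  holds⇒sat (φ ⇒ ψ)  ρ h s = holds⇒sat ψ ρ (h (sat⇒holds φ ρ s))
  holds⇒sat (φ ∧f ψ) ρ (h , h′) = holds⇒sat φ ρ h , holds⇒sat ψ ρ h′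
  holds⇒sat (φ ∨f ψ) ρ (inj₁ h) = inj₁ (holds⇒sat φ ρ h)
  holds⇒sat (φ ∨f ψ) ρ (inj₂ h) = inj₂ (holds⇒sat ψ ρ h)
  holds⇒sat (∀f φ)   ρ h a = holds⇒sat φ (ext ρ a) (h a)
  holds⇒sat (∃f φ)   ρ (a , h) = a , holds⇒sat φ (ext ρ a) h

presentations-≡ₑ : {P : PAStr} (𝒫 𝒬 : Presentation P) → structure 𝒫 ≡ₑ structure 𝒬
presentations-≡ₑ 𝒫 𝒬 σ =
  (λ s → holds⇒sat 𝒬 σ _ (sat⇒holds 𝒫 σ _ s)) ,
  (λ s → holds⇒sat 𝒫 σ _ (sat⇒holds 𝒬 σ _ s))

transfer : {M : PAStr} → ModelOfTrueArithmetic M → (σ : Sentence) → ℕStr ⊩ σ → M ⊩ σ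
transfer {M} mta σ h = sat⇒holds (graphs M) σ _ (mta σ (holds⇒sat (graphs ℕStr) σ _ h))

module Fractions (P : PAStr) where
  open PAStr P
  open KM P

  ⟨_⟩ : Carrier → GFrac
  ⟨ a ⟩ = frac (false , a , 1#)

record FractionFacts (P : PAStr) : Set where
  open PAStr P
  open KM P
  open Fractions P
  field
    0<1        : 0# < 1#
    0<2        : 0# < (1# + 1#)
    unbounded  : ∀ n → Σ Carrier (n <_)
    close-refl : ∀ m a → Close m ⟨ a ⟩ ⟨ a ⟩
    close₁⇒≡   : ∀ a b → Close 1# ⟨ a ⟩ ⟨ b ⟩ → a ≡ b
    close-+    : ∀ m a b → Close m ⟨ a + b ⟩ (addG ⟨ a ⟩ ⟨ b ⟩)
    close₁-+⇒  : ∀ a b c → Close 1# ⟨ c ⟩ (addG ⟨ a ⟩ ⟨ b ⟩) → a + b ≡ c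
    close-*    : ∀ m a b → Close m ⟨ a * b ⟩ (mulG ⟨ a ⟩ ⟨ b ⟩)
    close₁-*⇒  : ∀ a b c → Close 1# ⟨ c ⟩ (mulG ⟨ a ⟩ ⟨ b ⟩) → a * b ≡ c
    ltBy⇒<     : ∀ m a b → LtBy m ⟨ a ⟩ ⟨ b ⟩ → a < b
    <⇒ltBy₂    : ∀ a b → a < b → LtBy (1# + 1#) ⟨ a ⟩ ⟨ b ⟩

ℕ-fractionFacts : FractionFacts ℕStr
ℕ-fractionFacts = record
  { 0<1        = s≤s z≤n
  ; 0<2        = s≤s z≤n
  ; unbounded  = λ n → suc n , ℕ.n<1+n n
  ; close-refl = λ m a → ℕ.n<1+n _ , ℕ.n<1+n _
  ; close₁⇒≡   = close₁⇒≡
  ; close-+    = close-+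
  ; close₁-+⇒  = close₁-+⇒
  ; close-*    = close-*
  ; close₁-*⇒  = close₁-*⇒
  ; ltBy⇒<     = ltBy⇒<
  ; <⇒ltBy₂    = <⇒ltBy₂
  }
  where
  open KM ℕStr
  open Fractions ℕStr
  open Data.Nat using (_+_; _*_; _≤_; _<_)

  ≡⇒<suc-both : ∀ {x y} → x ≡ y → x < suc y × y < suc x
  ≡⇒<suc-both x≡y = s≤s (ℕ.≤-reflexive x≡y) , s≤s (ℕ.≤-reflexive (sym x≡y))

  <suc-both⇒≡ : ∀ {x y} → x < suc y → y < suc x → x ≡ y
  <suc-both⇒≡ p q = ℕ.≤-antisym (ℕ.m<1+n⇒m≤n p) (ℕ.m<1+n⇒m≤n q)

  close₁⇒≡ : ∀ a b → Close 1 ⟨ a ⟩ ⟨ b ⟩ → a ≡ b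
  close₁⇒≡ a b (p , q) = begin
    a                ≡⟨ solve (a ∷ []) ⟩
    1 * (1 * a) + 0  ≡⟨ <suc-both⇒≡ p q ⟩
    1 * (1 * b) + 0  ≡⟨ solve (b ∷ []) ⟩
    b                ∎
    where open ≡-Reasoning

  close-+ : ∀ m a b → Close m ⟨ a + b ⟩ (addG ⟨ a ⟩ ⟨ b ⟩)
  close-+ m a b = ≡⇒<suc-both distrib
    where
    distrib : m * ((1 * 1) * (a + b)) + 0 ≡ m * (1 * (1 * a)) + (m * (1 * (1 * b)) + 0)
    distrib = solve (m ∷ a ∷ b ∷ [])

  close₁-+⇒ : ∀ a b c → Close 1 ⟨ c ⟩ (addG ⟨ a ⟩ ⟨ b ⟩) → a + b ≡ c
  close₁-+⇒ a b c (p , q) = begin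
    a + b                                        ≡⟨ solve (a ∷ b ∷ []) ⟩
    1 * (1 * (1 * a)) + (1 * (1 * (1 * b)) + 0)  ≡⟨ <suc-both⇒≡ q p ⟩
    1 * ((1 * 1) * c) + 0                        ≡⟨ solve (c ∷ []) ⟩
    c                                            ∎
    where open ≡-Reasoning

  close-* : ∀ m a b → Close m ⟨ a * b ⟩ (mulG ⟨ a ⟩ ⟨ b ⟩)
  close-* m a b = ≡⇒<suc-both reassoc
    where
    reassoc : m * ((1 * 1) * (a * b)) + 0 ≡ m * (1 * (a * b)) + 0
    reassoc = solve (m ∷ a ∷ b ∷ [])

  close₁-*⇒ : ∀ a b c → Close 1 ⟨ c ⟩ (mulG ⟨ a ⟩ ⟨ b ⟩) → a * b ≡ c
  close₁-*⇒ a b c (p , q) = begin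
    a * b                  ≡⟨ solve (a ∷ b ∷ []) ⟩
    1 * (1 * (a * b)) + 0  ≡⟨ <suc-both⇒≡ q p ⟩
    1 * ((1 * 1) * c) + 0  ≡⟨ solve (c ∷ []) ⟩
    c                      ∎
    where open ≡-Reasoning

  ltBy⇒< : ∀ m a b → LtBy m ⟨ a ⟩ ⟨ b ⟩ → a < b
  ltBy⇒< m a b h = ℕ.*-cancelˡ-< m a b (begin-strict
    m * a            ≡⟨ solve (m ∷ a ∷ []) ⟩
    m * (1 * a) + 0  <⟨ ℕ.<⇒≤ h ⟩
    m * (1 * b) + 0  ≡⟨ solve (m ∷ b ∷ []) ⟩
    m * b            ∎)
    where open ℕ.≤-Reasoning

  <⇒ltBy₂ : ∀ a b → a < b → LtBy 2 ⟨ a ⟩ ⟨ b ⟩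
  <⇒ltBy₂ a b a<b = begin
    suc (1 + (2 * (1 * a) + 0))  ≡⟨ solve (a ∷ []) ⟩
    2 * suc a                    ≤⟨ ℕ.*-monoʳ-≤ 2 a<b ⟩
    2 * b                        ≡⟨ solve (b ∷ []) ⟩
    2 * (1 * b) + 0              ∎
    where open ℕ.≤-Reasoning

-- Instantiating KM with terms turns fractions over M into fractions of terms;
-- the order field is never consulted.
TermAlgebra : ℕ → PAStr
TermAlgebra n = record
  { Carrier = Term n ; 0# = zer ; 1# = one ; _+_ = _⊕_ ; _*_ = _⊗_ ; _<_ = λ _ _ → ⊤ }

module FractionFormulas {n : ℕ} where
  open KM (TermAlgebra n) using (SList; GFrac; posPart; negPart; scale; diffNum)
  open KM (TermAlgebra n) public using (addG; mulG)
  open Fractions (TermAlgebra n) public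

  PositiveF : SList → Formula n
  PositiveF l = negPart l ≺ posPart l

  CloseF : Term n → GFrac → GFrac → Formula n
  CloseF m x@(_ , d₁) y@(_ , d₂) =
    PositiveF ((false , d₁ ⊗ d₂) ∷ scale (true , m) (diffNum x y)) ∧f
    PositiveF ((false , d₁ ⊗ d₂) ∷ scale (false , m) (diffNum x y))

  LtByF : Term n → GFrac → GFrac → Formula n
  LtByF m x@(_ , d₁) y@(_ , d₂) =
    PositiveF ((true , d₁ ⊗ d₂) ∷ scale (false , m) (diffNum y x))

  v₀ : Term (suc n)
  v₀ = var zero

  v₁ : Term (suc (suc n))
  v₁ = var (suc zero)

  v₂ : Term (suc (suc (suc n)))
  v₂ = var (suc (suc zero))

-- On the concrete fractions below, CloseF and LtByF evaluate to Close and LtBy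
-- on the nose, so each sentence expresses the field it is used for.
transferFractionFacts : {M : PAStr} → ModelOfTrueArithmetic M → FractionFacts M
transferFractionFacts {M} mta = record
  { 0<1        = fromℕ (zer ≺ one) 0<1
  ; 0<2        = fromℕ (zer ≺ (one ⊕ one)) 0<2
  ; unbounded  = fromℕ (∀f (∃f (v₁ ≺ v₀))) unbounded
  ; close-refl = fromℕ (∀f (∀f (CloseF v₁ ⟨ v₀ ⟩ ⟨ v₀ ⟩))) close-refl
  ; close₁⇒≡   = fromℕ (∀f (∀f (CloseF one ⟨ v₁ ⟩ ⟨ v₀ ⟩ ⇒ (v₁ ≐ v₀)))) close₁⇒≡
  ; close-+    = fromℕ (∀f (∀f (∀f (CloseF v₂ ⟨ v₁ ⊕ v₀ ⟩ (addG ⟨ v₁ ⟩ ⟨ v₀ ⟩))))) close-+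
  ; close₁-+⇒  = fromℕ (∀f (∀f (∀f (CloseF one ⟨ v₀ ⟩ (addG ⟨ v₂ ⟩ ⟨ v₁ ⟩) ⇒ ((v₂ ⊕ v₁) ≐ v₀)))))
                       close₁-+⇒
  ; close-*    = fromℕ (∀f (∀f (∀f (CloseF v₂ ⟨ v₁ ⊗ v₀ ⟩ (mulG ⟨ v₁ ⟩ ⟨ v₀ ⟩))))) close-*
  ; close₁-*⇒  = fromℕ (∀f (∀f (∀f (CloseF one ⟨ v₀ ⟩ (mulG ⟨ v₂ ⟩ ⟨ v₁ ⟩) ⇒ ((v₂ ⊗ v₁) ≐ v₀)))))
                       close₁-*⇒
  ; ltBy⇒<     = fromℕ (∀f (∀f (∀f (LtByF v₂ ⟨ v₁ ⟩ ⟨ v₀ ⟩ ⇒ (v₁ ≺ v₀))))) ltBy⇒<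
  ; <⇒ltBy₂    = fromℕ (∀f (∀f ((v₁ ≺ v₀) ⇒ LtByF (one ⊕ one) ⟨ v₁ ⟩ ⟨ v₀ ⟩))) <⇒ltBy₂
  }
  where
  open FractionFacts ℕ-fractionFacts
  open FractionFormulas

  fromℕ : (σ : Sentence) → ℕStr ⊩ σ → M ⊩ σ
  fromℕ = transfer mta

module Sequences (M : PAStr) where
  open PAStr M
  open KM M

  ∼-of-close : (x y : Seq) → (∀ m k → Close m (x k) (y k)) → x ∼ y
  ∼-of-close x y close m _ = 0# , λ k _ → close m k

module ConstantClasses {M : PAStr} (F : FractionFacts M) where
  open PAStr M
  open KM M
  open FractionFacts F
  open Sequences M

  ∼⇒close₁ : (x y : Seq) → x ∼ y → Σ Carrier λ k → Close 1# (x k) (y k)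
  ∼⇒close₁ x y x∼y =
    let (n , close) = x∼y 1# 0<1
        (k , n<k)   = unbounded n
    in  k , close k n<k

  <K-of-ltBy₂ : (x y : Seq) → (∀ k → LtBy (1# + 1#) (x k) (y k)) → x <K y
  <K-of-ltBy₂ x y lt = 1# + 1# , 0# , 0<2 , λ k _ → lt k

  <K⇒ltBy : (x y : Seq) → x <K y → Σ Carrier λ m → Σ Carrier λ k → LtBy m (x k) (y k)
  <K⇒ltBy x y (m , n , _ , lt) = let (k , n<k) = unbounded n in m , k , lt k n<k

  cst-∼⇔≡ : ∀ {a b} → cst a ∼ cst b ⇔ a ≡ b
  cst-∼⇔≡ {a} {b} = mk⇔
    (λ a∼b → close₁⇒≡ a b (proj₂ (∼⇒close₁ (cst a) (cst b) a∼b)))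
    (λ { refl → ∼-of-close (cst a) (cst a) (λ m _ → close-refl m a) })

  cst-∼-+⇔ : ∀ {a b c} → cst c ∼ (cst a +S cst b) ⇔ a + b ≡ c
  cst-∼-+⇔ {a} {b} {c} = mk⇔
    (λ c∼a+b → close₁-+⇒ a b c (proj₂ (∼⇒close₁ (cst c) (cst a +S cst b) c∼a+b)))
    (λ { refl → ∼-of-close (cst (a + b)) (cst a +S cst b) (λ m _ → close-+ m a b) })

  cst-∼-*⇔ : ∀ {a b c} → cst c ∼ (cst a *S cst b) ⇔ a * b ≡ c
  cst-∼-*⇔ {a} {b} {c} = mk⇔
    (λ c∼ab → close₁-*⇒ a b c (proj₂ (∼⇒close₁ (cst c) (cst a *S cst b) c∼ab)))
    (λ { refl → ∼-of-close (cst (a * b)) (cst a *S cst b) (λ m _ → close-* m a b) })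

  cst-<K⇔< : ∀ {a b} → cst a <K cst b ⇔ a < b
  cst-<K⇔< {a} {b} = mk⇔
    (λ a<Kb → let (m , k , lt) = <K⇒ltBy (cst a) (cst b) a<Kb in ltBy⇒< m a b lt)
    (λ a<b → <K-of-ltBy₂ (cst a) (cst b) (λ _ → <⇒ltBy₂ a b a<b))

  MK-presentation : Presentation M
  MK-presentation = record
    { _≈_ = λ a b → cst a ∼ cst b
    ; IsZ = λ a → cst a ∼ cst 0#
    ; IsO = λ a → cst a ∼ cst 1#
    ; Add = λ a b c → cst c ∼ (cst a +S cst b)
    ; Mul = λ a b c → cst c ∼ (cst a *S cst b)
    ; Lt  = λ a b → cst a <K cst b
    ; ≈⇔≡ = cst-∼⇔≡ ; IsZ⇔≡0 = cst-∼⇔≡ ; IsO⇔≡1 = cst-∼⇔≡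
    ; Add⇔+ = cst-∼-+⇔ ; Mul⇔* = cst-∼-*⇔ ; Lt⇔< = cst-<K⇔< }

mainTheorem9 : LEM → (M : PAStr) → ModelOfTrueArithmetic M →
    KM.MKClosed M × (KM.MK M ≡ₑ toRel M)
mainTheorem9 _ M mta =
  ((λ a b → a + b , from cst-∼-+⇔ refl) , (λ a b → a * b , from cst-∼-*⇔ refl)) ,
  presentations-≡ₑ MK-presentation (graphs M)
  where
  open PAStr M
  open ConstantClasses (transferFractionFacts mta)
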